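{- Let $G=(V,E)$ be an undirected simple graph with vertex labels in $\{1,\dots,n\}$, let $k\ge 1$ be an integer, and let $v\in V$ be a vertex whose connected component $\mathbf{C}(v)$ has at least $k$ vertices. Then for every integer $b\ge 1$, $$t_{k,b}(v)\le k^{2(k-1)}\cdot (k-1+b)^{k(k-1)}.$$
   Context: For a rooted tree $T$ and $x\in V(T)$, $\mathrm{dep}(x)$ is the length of the path in $T$ from the root to $x$; $\mathrm{lab}(x)\in\{1,\dots,n\}$ is the label of $x$. An edge $e=(u,w)\notin E(T)$ is a violating edge for $T$ if either (1) exactly one endpoint, say $u$, lies in $V(T)$, and there is $y\in V(T)$ with $\mathrm{dep}(y)-\mathrm{dep}(u)\ge 2$ or an edge $(u,x)\in E(T)$ with $\mathrm{lab}(x)>\mathrm{lab}(w)$; or (2) both $u,w\in V(T)$, their depths differ, say $\mathrm{dep}(u)<\mathrm{dep}(w)$, and either $\mathrm{dep}(w)-\mathrm{dep}(u)\ge 2$ or there is an edge $(u,x)\in E(T)$ with $\mathrm{lab}(x)>\mathrm{lab}(w)$. Collection procedure for an ordering $\sigma$ of $E$: if $k=1$ it produces the tree $\{v\}$. Otherwise start with the tree $F$ consisting only of the root $v$ and process the edges in the order $\sigma$: if the current edge is violating for $F$, stop and fail; else if exactly one endpoint $u$ of the edge $(u,w)$ lies in $V(F)$, add $w$ and $(u,w)$ to $F$, and fail if now $|V(F)|>k$. After all edges are processed, the procedure fails if $|V(F)|<k$, and otherwise (when $|V(F)|=k$) produces $F$. An LBFS tree rooted at $v$ of size $k$ is a tree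 produced (without failure) by this procedure for some ordering $\sigma$ of $E$; $\mathcal{T}_k(v)$ is the set of all of them. $\mathcal{T}_{k,b}(v)$ is the set of $T\in\mathcal{T}_k(v)$ with $|E(V(T),\mathbf{C}(v)\setminus V(T))|=b$ (number of edges of $G$ between $V(T)$ and the rest of the component), and $t_{k,b}(v)=|\mathcal{T}_{k,b}(v)|$. -}

module Defs where

open import Data.Nat using (ℕ; zero; suc; _+_; _≤ᵇ_; _<ᵇ_; _≡ᵇ_)
open import Data.Bool using (Bool; true; false; if_then_else_; _∧_; _∨_; not)
open import Data.Fin using (Fin; toℕ; _≟_)
open import Data.Vec using (Vec; lookup; replicate; _[_]≔_; tabulate)
open import Data.List using (List; []; _∷_; [_]; concatMap; allFin)
open import Data.Bool.ListAction using (any)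
open import Data.Maybe using (Maybe; just; nothing; _>>=_)
open import Data.Product using (_×_; _,_; Σ)
open import Data.Sum using (_⊎_)
open import Relation.Nullary using (¬_)
open import Relation.Nullary.Decidable using (⌊_⌋)
open import Relation.Binary.PropositionalEquality using (_≡_)
open import Relation.Binary.Construct.Closure.ReflexiveTransitive using (Star)
open import Data.List.Relation.Binary.Permutation.Propositional using (_↭_)

-- A simple undirected graph on the vertex set V = {1,…,n}, represented as Fin n;
-- vertex x has label lab x = toℕ x + 1.
record Graph (n : ℕ) : Set where
  field
    adj    : Fin n → Fin n → Bool
    sym    : ∀ i j → adj i j ≡ adj j i
    irrefl : ∀ i → adj i i ≡ false
open Graph public

lab : ∀ {n} → Fin n → ℕ
lab x = suc (toℕ x)

Edge : ℕ → Set
Edge n = Fin n × Fin n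

edges : ∀ {n} → Graph n → List (Edge n)
edges {n} G = concatMap (λ i → concatMap (λ j →
  if (toℕ i <ᵇ toℕ j) ∧ adj G i j then [ (i , j) ] else []) (allFin n)) (allFin n)

-- Reachability in G (connected component C(v) = {x | Reach G v x}).
Reach : ∀ {n} → Graph n → Fin n → Fin n → Set
Reach G = Star (λ i j → adj G i j ≡ true)

-- State of the collection procedure: the current tree F.
record St (n : ℕ) : Set where
  constructor st
  field
    inV  : Vec Bool n
    dep  : Vec ℕ n               -- depths (meaningful on V(F))
    tE   : Vec (Vec Bool n) n    -- adjacency matrix of E(F)
    size : ℕ
open St public

anyFin : ∀ {n} → (Fin n → Bool) → Bool
anyFin {n} p = any p (allFin n)

biggerNbr : ∀ {n} → St n → Fin n → Fin n → Bool
biggerNbr s u w = anyFin (λ x → lookup (lookup (tE s) u) x ∧ (lab w <ᵇ lab x))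

-- violation, case (1): u ∈ V(F), w ∉ V(F)
violOne : ∀ {n} → St n → Fin n → Fin n → Bool
violOne s u w =
  anyFin (λ y → lookup (inV s) y ∧ (lookup (dep s) u + 2 ≤ᵇ lookup (dep s) y))
  ∨ biggerNbr s u w

-- violation, case (2): u,w ∈ V(F), (u,w) ∉ E(F), dep u < dep w
violTwo : ∀ {n} → St n → Fin n → Fin n → Bool
violTwo s u w = (lookup (dep s) u + 2 ≤ᵇ lookup (dep s) w) ∨ biggerNbr s u w

addV : ∀ {n} → St n → Fin n → Fin n → St n
addV s u w = st (inV s [ w ]≔ true)
                (dep s [ w ]≔ suc (lookup (dep s) u))
                ((tE s [ u ]≔ (lookup (tE s) u [ w ]≔ true)) [ w ]≔
                   (lookup (tE s [ u ]≔ (lookup (tE s) u [ w ]≔ true)) w [ u ]≔ true))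
                (suc (size s))

-- processing one edge; nothing = failure
step : ∀ {n} → ℕ → St n → Edge n → Maybe (St n)
step k s (a , b) with lookup (inV s) a | lookup (inV s) b
... | false | false = just s
... | true  | false =
  if violOne s a b then nothing
  else (if k <ᵇ size (addV s a b) then nothing else just (addV s a b))
... | false | true =
  if violOne s b a then nothing
  else (if k <ᵇ size (addV s b a) then nothing else just (addV s b a))
... | true  | true =
  if lookup (lookup (tE s) a) b then just s
  else (if lookup (dep s) a <ᵇ lookup (dep s) b
          then (if violTwo s a b then nothing else just s)
          else (if lookup (dep s) b <ᵇ lookup (dep s) a
                  then (if violTwo s b a then nothing else just s)
                  else just s))

run : ∀ {n} → ℕ → St n → List (Edge n) → Maybe (St n)
run k s []       = just s
run k s (e ∷ σ)  = step k s e >>= λ s′ → run k s′ σ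

-- A rooted tree (root fixed to v) given by its vertex set and edge set.
Tree : ℕ → Set
Tree n = Vec Bool n × Vec (Vec Bool n) n

single : ∀ {n} → Fin n → Vec Bool n
single v = tabulate (λ x → ⌊ x ≟ v ⌋)

noEdges : ∀ {n} → Vec (Vec Bool n) n
noEdges = replicate _ (replicate _ false)

collect : ∀ {n} → Graph n → ℕ → Fin n → List (Edge n) → Maybe (Tree n)
collect G k v σ with k ≡ᵇ 1
... | true  = just (single v , noEdges)
... | false =
  run k (st (single v) (replicate _ 0) noEdges 1) σ >>= λ s →
    if size s ≡ᵇ k then just (inV s , tE s) else nothing

IsLBFS : ∀ {n} → Graph n → ℕ → Fin n → Tree n → Set
IsLBFS G k v T = Σ (List (Edge _)) λ σ → (σ ↭ edges G) × (collect G k v σ ≡ just T)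

Crossing : ∀ {n} → Graph n → Fin n → Tree n → Edge n → Set
Crossing G v (S , _) (a , b) =
  (lookup S a ≡ true × lookup S b ≡ false × Reach G v b)
  ⊎ (lookup S b ≡ true × lookup S a ≡ false × Reach G v a)

data CountP {A : Set} (P : A → Set) : List A → ℕ → Set where
  c-nil  : CountP P [] 0
  c-yes  : ∀ {x xs c} → P x → CountP P xs c → CountP P (x ∷ xs) (suc c)
  c-no   : ∀ {x xs c} → ¬ P x → CountP P xs c → CountP P (x ∷ xs) c

InTkb : ∀ {n} → Graph n → ℕ → ℕ → Fin n → Tree n → Set
InTkb G k b v T = IsLBFS G k v T × CountP (Crossing G v T) (edges G) b

-- A violating edge only ever makes the collection procedure fail, so a successful run only
-- attaches pendant edges (u , w) with u in the current tree and w outside it: every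
-- T ∈ 𝒯_{k,b}(v) is obtained by replaying a history of k − 1 such attachments. In T every vertex
-- has at most (k − 1) + b neighbours in G, namely the other tree vertices and the endpoints of
-- the b boundary edges. Recording each attachment as the pair (position of u among the vertices
-- present, position of w among the neighbours of u) encodes T by a word of length k − 1 over
-- k (k − 1 + b) letters, so t_{k,b}(v) ≤ (k (k − 1 + b))^(k − 1), which is at most the stated
-- bound.

module Submission where

open import Defs
open import Data.Nat using (ℕ; zero; suc; _≤_; _<_; _*_; _+_; _∸_; _^_; _<ᵇ_; _≡ᵇ_; z≤n; s≤s; >-nonZero)
open import Data.Nat.Properties
  using (≤-refl; ≤-trans; <⇒≤; <-≤-trans; ≤-pred; ≤∧≢⇒<; ≮⇒≥; +-mono-≤; *-mono-≤; +-suc;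
         ^-monoʳ-≤; m≤m+n; m≤n+m; m≤n*m; ≡ᵇ⇒≡; <ᵇ⇒<; <⇒<ᵇ; module ≤-Reasoning)
open import Data.Nat.Solver using (module +-*-Solver)
open import Data.Bool using (true; false; if_then_else_; _∧_; T)
open import Data.Bool.Properties using (T-≡; ¬-not) renaming (_≟_ to _≟ᵇ_)
open import Data.Fin using (Fin; toℕ; _≟_)
open import Data.Fin.Properties using (toℕ-injective)
open import Data.Vec using (lookup; replicate)
open import Data.Vec.Properties using (lookup∘update; lookup∘update′; lookup∘tabulate)
import Data.Vec.Properties as Vec
open import Data.List using (List; []; _∷_; [_]; _++_; length; map; filter; allFin; upTo; cartesianProductWith; cartesianProduct)
open import Data.List.Properties using (length-++; length-map; length-upTo; filter-notAll)
open import Data.List.Relation.Unary.All using (All; []; _∷_)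
import Data.List.Relation.Unary.All as All
open import Data.List.Relation.Unary.All.Properties using (map⁺)
open import Data.List.Relation.Unary.Any using (here; there)
import Data.List.Relation.Unary.Any as Any
open import Data.List.Relation.Unary.Unique.Propositional using (Unique)
import Data.List.Relation.Unary.Unique.Propositional.Properties as Unique
open import Data.List.Relation.Unary.AllPairs using (_∷_)
open import Data.List.Membership.Propositional using (_∈_; _∉_)
open import Data.List.Membership.Propositional.Properties
  using (∈-filter⁺; ∈-filter⁻; ∈-map⁺; ∈-allFin; ∈-upTo⁺; ∈-concatMap⁺; ∈-concatMap⁻; ∈-cartesianProductWith⁺)
open import Data.List.Relation.Binary.Permutation.Propositional.Properties using (∈-resp-↭)
open import Data.Maybe using (Maybe; just; nothing; _>>=_)
open import Data.Maybe.Properties using (just-injective)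
open import Data.Product using (Σ; ∃-syntax; _×_; _,_; proj₁; proj₂)
import Data.Product.Properties as Product
open import Data.Sum using (_⊎_; inj₁; inj₂)
open import Function using (_∘_; Equivalence)
open import Relation.Nullary using (¬_; yes; no; ¬?; contradiction)
open import Relation.Nullary.Decidable using (⌊_⌋; toWitness; fromWitness)
open import Relation.Unary using (Decidable)
open import Relation.Unary.Properties using (∁?)
open import Relation.Binary.Definitions using (DecidableEquality)
open import Relation.Binary.PropositionalEquality
  using (_≡_; _≢_; refl; trans; cong; cong₂; subst; module ≡-Reasoning) renaming (sym to ≡-sym)
open import Relation.Binary.Construct.Closure.ReflexiveTransitive using (ε; _◅_; _◅◅_)

CountP⇒cover : ∀ {A : Set} {P : A → Set} {xs c} → CountP P xs c →
               ∃[ ys ] length ys ≡ c × (∀ {x} → x ∈ xs → P x → x ∈ ys)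
CountP⇒cover c-nil = [] , refl , λ ()
CountP⇒cover (c-yes {x} Px count) with ys , refl , covers ← CountP⇒cover count =
  x ∷ ys , refl , λ { (here refl) _ → here refl ; (there x∈) Py → there (covers x∈ Py) }
CountP⇒cover (c-no ¬Px count) with ys , refl , covers ← CountP⇒cover count =
  ys , refl , λ { (here refl) Py → contradiction Py ¬Px ; (there x∈) Py → covers x∈ Py }

module _ {A : Set} (_≟ᴬ_ : DecidableEquality A) where

  Unique-⊆⇒length≤ : ∀ {xs ys : List A} → Unique xs → All (_∈ ys) xs → length xs ≤ length ys
  Unique-⊆⇒length≤ {[]} _ _ = z≤n
  Unique-⊆⇒length≤ {x ∷ xs} {ys} (x∉xs ∷ xs!) (x∈ys ∷ xs⊆ys) =
    ≤-trans (s≤s (Unique-⊆⇒length≤ xs! (All.zipWith keep (x∉xs , xs⊆ys))))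
            (filter-notAll ≢x? ys (Any.map (λ x≡y y≢x → y≢x (≡-sym x≡y)) x∈ys))
    where
    ≢x? : Decidable (_≢ x)
    ≢x? y = ¬? (y ≟ᴬ x)
    keep : ∀ {z} → x ≢ z × z ∈ ys → z ∈ filter ≢x? ys
    keep (x≢z , z∈ys) = ∈-filter⁺ ≢x? z∈ys (x≢z ∘ ≡-sym)

  CountP-bound : ∀ {P : A → Set} {xs c zs} → CountP P xs c →
                 Unique zs → All (_∈ xs) zs → All P zs → length zs ≤ c
  CountP-bound count zs! zs⊆xs Pzs with ys , refl , covers ← CountP⇒cover count =
    Unique-⊆⇒length≤ zs! (All.zipWith (λ (z∈xs , Pz) → covers z∈xs Pz) (zs⊆xs , Pzs))

length-filter+filter-∁ : ∀ {A : Set} {P : A → Set} (P? : Decidable P) xs →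
                         length xs ≡ length (filter P? xs) + length (filter (∁? P?) xs)
length-filter+filter-∁ P? [] = refl
length-filter+filter-∁ P? (x ∷ xs) with P? x
... | yes _ = cong suc (length-filter+filter-∁ P? xs)
... | no _  = trans (cong suc (length-filter+filter-∁ P? xs)) (≡-sym (+-suc _ _))

length-cartesianProductWith : ∀ {A B C : Set} (f : A → B → C) xs ys →
                              length (cartesianProductWith f xs ys) ≡ length xs * length ys
length-cartesianProductWith f []       ys = refl
length-cartesianProductWith f (x ∷ xs) ys = begin
  length (map (f x) ys ++ cartesianProductWith f xs ys)
    ≡⟨ length-++ (map (f x) ys) ⟩
  length (map (f x) ys) + length (cartesianProductWith f xs ys)
    ≡⟨ cong₂ _+_ (length-map (f x) ys) (length-cartesianProductWith f xs ys) ⟩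
  length ys + length xs * length ys ∎
  where open ≡-Reasoning

words : ∀ {A : Set} → List A → ℕ → List (List A)
words xs zero    = [ [] ]
words xs (suc l) = cartesianProductWith _∷_ xs (words xs l)

length-words : ∀ {A : Set} (xs : List A) l → length (words xs l) ≡ length xs ^ l
length-words xs zero    = refl
length-words xs (suc l) =
  trans (length-cartesianProductWith _∷_ xs (words xs l)) (cong (length xs *_) (length-words xs l))

codes : ℕ → ℕ → ℕ → List (List (ℕ × ℕ))
codes k m = words (cartesianProduct (upTo k) (upTo m))

length-codes : ∀ k m l → length (codes k m l) ≡ (k * m) ^ l
length-codes k m l = trans (length-words _ l) (cong (_^ l) (begin
  length (cartesianProduct (upTo k) (upTo m)) ≡⟨ length-cartesianProductWith _,_ (upTo k) (upTo m) ⟩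
  length (upTo k) * length (upTo m)           ≡⟨ cong₂ _*_ (length-upTo k) (length-upTo m) ⟩
  k * m                                       ∎))
  where open ≡-Reasoning

lookupOr : ∀ {A : Set} → A → List A → ℕ → A
lookupOr d []       _       = d
lookupOr d (x ∷ xs) zero    = x
lookupOr d (x ∷ xs) (suc i) = lookupOr d xs i

∈⇒lookupOr : ∀ {A : Set} {x : A} {xs} (d : A) → x ∈ xs → ∃[ i ] i < length xs × lookupOr d xs i ≡ x
∈⇒lookupOr d (here refl) = zero , s≤s z≤n , refl
∈⇒lookupOr d (there x∈) with i , i< , eq ← ∈⇒lookupOr d x∈ = suc i , s≤s i< , eq

^-distrib-* : ∀ a b l → (a * b) ^ l ≡ a ^ l * b ^ l
^-distrib-* a b zero    = refl
^-distrib-* a b (suc l) = begin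
  a * b * (a * b) ^ l     ≡⟨ cong (a * b *_) (^-distrib-* a b l) ⟩
  a * b * (a ^ l * b ^ l) ≡⟨ solve 4 (λ a b x y → a :* b :* (x :* y) := a :* x :* (b :* y)) refl a b (a ^ l) (b ^ l) ⟩
  a * a ^ l * (b * b ^ l) ∎
  where open ≡-Reasoning
        open +-*-Solver

[k*m]^l≤ : ∀ {k m} l → 1 ≤ k → 1 ≤ m → (k * m) ^ l ≤ k ^ (2 * l) * m ^ (k * l)
[k*m]^l≤ {k} {m} l 1≤k 1≤m = begin
  (k * m) ^ l     ≡⟨ ^-distrib-* k m l ⟩
  k ^ l * m ^ l   ≤⟨ *-mono-≤ (^-monoʳ-≤ k {{>-nonZero 1≤k}} (m≤m+n l (l + 0)))
                              (^-monoʳ-≤ m {{>-nonZero 1≤m}} (m≤n*m l k {{>-nonZero 1≤k}})) ⟩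
  k ^ (2 * l) * m ^ (k * l) ∎
  where open ≤-Reasoning

if-nothing : ∀ {A : Set} c {m : Maybe A} {x} → (if c then nothing else m) ≡ just x → m ≡ just x
if-nothing false eq = eq

Attaches : ∀ {n} → St n → Fin n → Fin n → St n → Set
Attaches s u w s′ = lookup (inV s) u ≡ true × lookup (inV s) w ≡ false × s′ ≡ addV s u w

step-cases : ∀ {n} k (s : St n) {a b s′} → step k s (a , b) ≡ just s′ →
             s′ ≡ s ⊎ Attaches s a b s′ ⊎ Attaches s b a s′
step-cases k s {a} {b} eq with lookup (inV s) a | lookup (inV s) b
... | false | false = inj₁ (≡-sym (just-injective eq))
... | true  | false =
  inj₂ (inj₁ (refl , refl , ≡-sym (just-injective (if-nothing (k <ᵇ suc (size s)) (if-nothing (violOne s a b) eq)))))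
... | false | true  =
  inj₂ (inj₂ (refl , refl , ≡-sym (just-injective (if-nothing (k <ᵇ suc (size s)) (if-nothing (violOne s b a) eq)))))
... | true  | true  = inj₁ (unchanged (lookup (lookup (tE s) a) b)
  (lookup (dep s) a <ᵇ lookup (dep s) b) (violTwo s a b) (lookup (dep s) b <ᵇ lookup (dep s) a) (violTwo s b a) eq)
  where
  unchanged : ∀ {A : Set} {s s′ : A} c₁ c₂ c₃ c₄ c₅ →
              (if c₁ then just s else (if c₂ then (if c₃ then nothing else just s)
                else (if c₄ then (if c₅ then nothing else just s) else just s))) ≡ just s′ → s′ ≡ s
  unchanged true  _     _     _     _     refl = refl
  unchanged false true  false _     _     refl = refl
  unchanged false false _     true  false refl = refl
  unchanged false false _     false _     refl = refl

module Growth {n} (G : Graph n) (v : Fin n) where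

  Adjacent : Edge n → Set
  Adjacent (a , b) = adj G a b ≡ true

  adj⇒≢ : ∀ {u w} → adj G u w ≡ true → u ≢ w
  adj⇒≢ {u} uw refl with () ← trans (≡-sym uw) (irrefl G u)

  -- A history lists the attachments (u , w) made so far, latest first: w was attached to the tree at u.
  vertices : List (Edge n) → List (Fin n)
  vertices []             = [ v ]
  vertices ((_ , w) ∷ ps) = w ∷ vertices ps

  length-vertices : ∀ ps → length (vertices ps) ≡ suc (length ps)
  length-vertices []       = refl
  length-vertices (_ ∷ ps) = cong suc (length-vertices ps)

  replay : List (Edge n) → St n
  replay []             = st (single v) (replicate n 0) noEdges 1
  replay ((u , w) ∷ ps) = addV (replay ps) u w

  size-replay : ∀ ps → size (replay ps) ≡ suc (length ps)
  size-replay []       = refl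
  size-replay (_ ∷ ps) = cong suc (size-replay ps)

  treeOf : List (Edge n) → Tree n
  treeOf ps = inV (replay ps) , tE (replay ps)

  data Grows : List (Edge n) → Set where
    []     : Grows []
    attach : ∀ {ps u w} → Grows ps → u ∈ vertices ps → w ∉ vertices ps → adj G u w ≡ true →
             Grows ((u , w) ∷ ps)

  ∈-vertices⇒inV : ∀ ps {x} → x ∈ vertices ps → lookup (inV (replay ps)) x ≡ true
  ∈-vertices⇒inV []       (here refl) = trans (lookup∘tabulate _ v) (Equivalence.to T-≡ (fromWitness refl))
  ∈-vertices⇒inV (_ ∷ ps) (here refl) = lookup∘update _ (inV (replay ps)) true
  ∈-vertices⇒inV ((_ , w) ∷ ps) {x} (there x∈) with x ≟ w
  ... | yes refl = lookup∘update x (inV (replay ps)) true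
  ... | no x≢w   = trans (lookup∘update′ x≢w (inV (replay ps)) true) (∈-vertices⇒inV ps x∈)

  inV⇒∈-vertices : ∀ ps {x} → lookup (inV (replay ps)) x ≡ true → x ∈ vertices ps
  inV⇒∈-vertices [] {x} x∈ =
    here (toWitness (Equivalence.from T-≡ (trans (≡-sym (lookup∘tabulate _ x)) x∈)))
  inV⇒∈-vertices ((_ , w) ∷ ps) {x} x∈ with x ≟ w
  ... | yes refl = here refl
  ... | no x≢w   = there (inV⇒∈-vertices ps (trans (≡-sym (lookup∘update′ x≢w (inV (replay ps)) true)) x∈))

  Grows-attach : ∀ {ps u w} → Grows ps → lookup (inV (replay ps)) u ≡ true →
                 lookup (inV (replay ps)) w ≡ false → adj G u w ≡ true → Grows ((u , w) ∷ ps)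
  Grows-attach {ps} g u∈ w∉ uw =
    attach g (inV⇒∈-vertices ps u∈) (λ w∈ → contradiction (trans (≡-sym (∈-vertices⇒inV ps w∈)) w∉) λ ()) uw

  Grows⇒Reach : ∀ {ps x} → Grows ps → x ∈ vertices ps → Reach G v x
  Grows⇒Reach []                 (here refl) = ε
  Grows⇒Reach (attach g u∈ _ uw) (here refl) = Grows⇒Reach g u∈ ◅◅ (uw ◅ ε)
  Grows⇒Reach (attach g _  _ _)  (there x∈)  = Grows⇒Reach g x∈

  step-replay : ∀ k {ps e s′} → Grows ps → Adjacent e → step k (replay ps) e ≡ just s′ →
                ∃[ ps′ ] Grows ps′ × s′ ≡ replay ps′
  step-replay k {ps} {a , b} g ab stepped with step-cases k (replay ps) stepped
  ... | inj₁ refl                    = ps , g , refl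
  ... | inj₂ (inj₁ (a∈ , b∉ , refl)) = (a , b) ∷ ps , Grows-attach g a∈ b∉ ab , refl
  ... | inj₂ (inj₂ (b∈ , a∉ , refl)) = (b , a) ∷ ps , Grows-attach g b∈ a∉ (trans (sym G b a) ab) , refl

  run-replay : ∀ k σ {ps s′} → Grows ps → All Adjacent σ → run k (replay ps) σ ≡ just s′ →
               ∃[ ps′ ] Grows ps′ × s′ ≡ replay ps′
  run-replay k []      g []         refl = _ , g , refl
  run-replay k (e ∷ σ) {ps} g (ae ∷ aσ) ran with step k (replay ps) e in stepped
  ... | just s with ps′ , g′ , refl ← step-replay k g ae stepped = run-replay k σ g′ aσ ran

  record Grown (k : ℕ) (T : Tree n) : Set where
    constructor grown
    field
      history        : List (Edge n)
      grows          : Grows history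
      length-history : suc (length history) ≡ k
      tree≡          : T ≡ treeOf history

  -- The branch of collect taken when k ≢ 1.
  accepted : ∀ k σ {T} → All Adjacent σ →
             (run k (replay []) σ >>= λ s → if size s ≡ᵇ k then just (inV s , tE s) else nothing) ≡ just T →
             Grown k T
  accepted k σ aσ eq with run k (replay []) σ in ran
  accepted k σ aσ () | nothing
  ... | just s with ps , g , refl ← run-replay k σ [] aσ ran with size (replay ps) ≡ᵇ k in sized
  ...   | true with refl ← eq =
    grown ps g (trans (≡-sym (size-replay ps)) (≡ᵇ⇒≡ _ k (Equivalence.from T-≡ sized))) refl

  collect-grown : ∀ k σ {T} → All Adjacent σ → collect G k v σ ≡ just T → Grown k T
  collect-grown 1             σ _ refl = grown [] [] refl refl
  collect-grown 0             σ        = accepted 0 σ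
  collect-grown (suc (suc k)) σ        = accepted (suc (suc k)) σ

  ∈-edges⁻ : ∀ {e} → e ∈ edges G → Adjacent e
  ∈-edges⁻ {e} e∈ =
    let x , e∈x = Any.satisfied (∈-concatMap⁻ _ {xs = allFin n} e∈)
        y , e∈xy = Any.satisfied (∈-concatMap⁻ _ {xs = allFin n} e∈x)
    in ∈-if⁻ x y e∈xy
    where
    ∈-if⁻ : ∀ x y {e} → e ∈ (if (toℕ x <ᵇ toℕ y) ∧ adj G x y then [ (x , y) ] else []) → Adjacent e
    ∈-if⁻ x y e∈ with toℕ x <ᵇ toℕ y | adj G x y in xy
    ∈-if⁻ x y (here refl) | true | true = xy

  ∈-edges⁺ : ∀ {i j} → toℕ i < toℕ j → adj G i j ≡ true → (i , j) ∈ edges G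
  ∈-edges⁺ {i} {j} i<j ij =
    ∈-concatMap⁺ _ (Any.map (λ { refl → ∈-concatMap⁺ _ (Any.map (λ { refl → ∈-if }) (∈-allFin j)) }) (∈-allFin i))
    where
    ∈-if : (i , j) ∈ (if (toℕ i <ᵇ toℕ j) ∧ adj G i j then [ (i , j) ] else [])
    ∈-if rewrite Equivalence.to T-≡ (<⇒<ᵇ i<j) | ij = here refl

  orient : Fin n → Fin n → Edge n
  orient u w = if toℕ u <ᵇ toℕ w then (u , w) else (w , u)

  orient-injective : ∀ u {w₁ w₂} → orient u w₁ ≡ orient u w₂ → w₁ ≡ w₂
  orient-injective u {w₁} {w₂} eq with toℕ u <ᵇ toℕ w₁ | toℕ u <ᵇ toℕ w₂
  ... | true  | true  = cong proj₂ eq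
  ... | false | false = cong proj₁ eq
  ... | true  | false = trans (cong proj₂ eq) (cong proj₁ eq)
  ... | false | true  = trans (cong proj₁ eq) (cong proj₂ eq)

  orient-∈-edges : ∀ {u w} → adj G u w ≡ true → orient u w ∈ edges G
  orient-∈-edges {u} {w} uw with toℕ u <ᵇ toℕ w in u<ᵇw
  ... | true  = ∈-edges⁺ (<ᵇ⇒< _ _ (Equivalence.from T-≡ u<ᵇw)) uw
  ... | false = ∈-edges⁺ w<u (trans (sym G w u) uw)
    where
    w<u : toℕ w < toℕ u
    w<u = ≤∧≢⇒< (≮⇒≥ (λ u<w → subst T u<ᵇw (<⇒<ᵇ u<w))) (adj⇒≢ uw ∘ ≡-sym ∘ toℕ-injective)

  orient-Crossing : ∀ {S E u w} → lookup S u ≡ true → lookup S w ≡ false → Reach G v w →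
                    Crossing G v (S , E) (orient u w)
  orient-Crossing {u = u} {w} u∈ w∉ reach with toℕ u <ᵇ toℕ w
  ... | true  = inj₁ (u∈ , w∉ , reach)
  ... | false = inj₂ (u∈ , w∉ , reach)

  neighbours : Fin n → List (Fin n)
  neighbours u = filter (λ x → adj G u x ≟ᵇ true) (allFin n)

  ∈-neighbours⁺ : ∀ {u w} → adj G u w ≡ true → w ∈ neighbours u
  ∈-neighbours⁺ {u} {w} uw = ∈-filter⁺ (λ x → adj G u x ≟ᵇ true) (∈-allFin w) uw

  ∈-neighbours⁻ : ∀ {u w} → w ∈ neighbours u → adj G u w ≡ true
  ∈-neighbours⁻ {u} w∈ = proj₂ (∈-filter⁻ (λ x → adj G u x ≟ᵇ true) {xs = allFin n} w∈)

  neighbours-Unique : ∀ u → Unique (neighbours u)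
  neighbours-Unique u = Unique.filter⁺ (λ x → adj G u x ≟ᵇ true) (Unique.allFin⁺ n)

  degree-bound : ∀ {ps b u} → Grows ps → CountP (Crossing G v (treeOf ps)) (edges G) b →
                 u ∈ vertices ps → length (neighbours u) ≤ length ps + b
  degree-bound {ps} {b} {u} g count u∈ = begin
    length (neighbours u)       ≡⟨ length-filter+filter-∁ inside? (neighbours u) ⟩
    length inner + length outer ≤⟨ +-mono-≤ inner-bound outer-bound ⟩
    length ps + b               ∎
    where
    open ≤-Reasoning
    inside? : Decidable (λ x → lookup (inV (replay ps)) x ≡ true)
    inside? x = lookup (inV (replay ps)) x ≟ᵇ true
    inner outer : List (Fin n)
    inner = filter inside? (neighbours u)
    outer = filter (∁? inside?) (neighbours u)

    ∈-inner : ∀ {x} → x ∈ inner → x ∈ neighbours u × lookup (inV (replay ps)) x ≡ true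
    ∈-inner = ∈-filter⁻ inside? {xs = neighbours u}
    ∈-outer : ∀ {x} → x ∈ outer → x ∈ neighbours u × ¬ lookup (inV (replay ps)) x ≡ true
    ∈-outer = ∈-filter⁻ (∁? inside?) {xs = neighbours u}

    inner-bound : length inner ≤ length ps
    inner-bound = ≤-pred (subst (suc (length inner) ≤_) (length-vertices ps)
      (Unique-⊆⇒length≤ _≟_ (All.tabulate (λ x∈ → adj⇒≢ (∈-neighbours⁻ (proj₁ (∈-inner x∈))))
                               ∷ Unique.filter⁺ inside? (neighbours-Unique u))
                            (u∈ ∷ All.tabulate (inV⇒∈-vertices ps ∘ proj₂ ∘ ∈-inner))))

    crossing : ∀ {x} → x ∈ outer → orient u x ∈ edges G × Crossing G v (treeOf ps) (orient u x)
    crossing x∈ with ux ← ∈-neighbours⁻ (proj₁ (∈-outer x∈)) =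
      orient-∈-edges ux ,
      orient-Crossing {S = inV (replay ps)} {tE (replay ps)}
        (∈-vertices⇒inV ps u∈) (¬-not (proj₂ (∈-outer x∈))) (Grows⇒Reach g u∈ ◅◅ (ux ◅ ε))

    outer-bound : length outer ≤ b
    outer-bound = subst (_≤ b) (length-map (orient u) outer)
      (CountP-bound (Product.≡-dec _≟_ _≟_) count
        (Unique.map⁺ (orient-injective u) (Unique.filter⁺ (∁? inside?) (neighbours-Unique u)))
        (map⁺ (All.tabulate (proj₁ ∘ crossing)))
        (map⁺ (All.tabulate (proj₂ ∘ crossing))))

  decode : List (ℕ × ℕ) → List (Edge n)
  decode []             = []
  decode ((i , j) ∷ cs) =
    let ps = decode cs
        u  = lookupOr v (vertices ps) i
    in (u , lookupOr v (neighbours u) j) ∷ ps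

  encode : ∀ {k m ps} → Grows ps → length ps < k → (∀ {x} → x ∈ vertices ps → length (neighbours x) ≤ m) →
           ∃[ cs ] cs ∈ codes k m (length ps) × decode cs ≡ ps
  encode [] _ _ = [] , here refl , refl
  encode {k} {m} {(_ , _) ∷ ps} (attach g u∈ _ uw) len deg
    with cs , cs∈ , refl ← encode g (<⇒≤ len) (deg ∘ there)
       | i , i<|ps| , refl ← ∈⇒lookupOr v u∈
       | j , j<deg  , refl ← ∈⇒lookupOr v (∈-neighbours⁺ uw) =
    (i , j) ∷ cs , ∈-cartesianProductWith⁺ _∷_ (∈-cartesianProductWith⁺ _,_ (∈-upTo⁺ i<k) (∈-upTo⁺ j<m)) cs∈ , refl
    where
    i<k = <-≤-trans (subst (i <_) (length-vertices ps) i<|ps|) (<⇒≤ len)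
    j<m = <-≤-trans j<deg (deg (there u∈))

  InTkb⇒∈-decoded : ∀ {k b T} → InTkb G k b v T → T ∈ map (treeOf ∘ decode) (codes k (k ∸ 1 + b) (k ∸ 1))
  InTkb⇒∈-decoded {k} ((σ , σ↭edges , collected) , count)
    with grown ps g refl refl ← collect-grown k σ (All.tabulate (∈-edges⁻ ∘ ∈-resp-↭ σ↭edges)) collected
    with cs , cs∈ , refl ← encode g ≤-refl (degree-bound g count) = ∈-map⁺ (treeOf ∘ decode) cs∈

lemma3 : ∀ {n} (G : Graph n) (k : ℕ) (v : Fin n) → 1 ≤ k
    → Σ (List (Fin n)) (λ C → Unique C × All (Reach G v) C × k ≤ length C)
    → ∀ (b : ℕ) → 1 ≤ b
    → ∀ (L : List (Tree n)) → Unique L → All (InTkb G k b v) L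
    → length L ≤ k ^ (2 * (k ∸ 1)) * (k ∸ 1 + b) ^ (k * (k ∸ 1))
lemma3 G k v 1≤k _ b 1≤b L L! trees = begin
  length L                                      ≤⟨ Unique-⊆⇒length≤ Tree-≟ L! (All.map (InTkb⇒∈-decoded {k}) trees) ⟩
  length (map (treeOf ∘ decode) (codes k m l)) ≡⟨ length-map (treeOf ∘ decode) (codes k m l) ⟩
  length (codes k m l)                          ≡⟨ length-codes k m l ⟩
  (k * m) ^ l                                   ≤⟨ [k*m]^l≤ l 1≤k (≤-trans 1≤b (m≤n+m b l)) ⟩
  k ^ (2 * l) * m ^ (k * l)                     ∎
  where
  open Growth G v
  open ≤-Reasoning
  l = k ∸ 1
  m = l + b
  Tree-≟ : DecidableEquality (Tree _)
  Tree-≟ = Product.≡-dec (Vec.≡-dec _≟ᵇ_) (Vec.≡-dec (Vec.≡-dec _≟ᵇ_))
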